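{- If a finite graph $G$ is equistarable, then every connected component of $G$ is equistarable. On the other hand, the class of equistarable graphs is not closed under taking disjoint unions: there exist equistarable graphs $G_1,G_2$ whose disjoint union is not equistarable.
   Context: For a vertex $v$, $E(v)$ denotes the set of edges incident with $v$ (the star rooted at $v$); such a star is maximal if not properly contained in another star $E(u)$. A graph $G=(V,E)$ without isolated vertices is equistarable if there is $\varphi:E\to\mathbb{R}_+$ such that for all $F\subseteq E$, $F$ is a maximal star iff $\sum_{e\in F}\varphi(e)=1$.
   Formalization: The weights $\varphi$ in the definition of equistarable graphs take values in the nonnegative rationals instead of $\mathbb{R}_+$. -}

module Defs where

open import Data.Nat using (ℕ; zero; suc; _+_; _≥_)
open import Data.Fin as Fin using (Fin; zero; suc; _≟_; _↑ˡ_; _↑ʳ_; splitAt)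
open import Data.Fin.Subset using (Subset; Side; inside; outside; _⊂_)
open import Data.Vec using (Vec; []; _∷_; tabulate)
open import Data.Rational using (ℚ; 0ℚ; 1ℚ) renaming (_+_ to _+ℚ_; _≤_ to _≤ℚ_)
open import Data.Product using (Σ; ∃; ∃-syntax; _×_; _,_; proj₁; proj₂)
open import Data.Sum using (_⊎_; inj₁; inj₂; [_,_])
open import Relation.Binary.PropositionalEquality using (_≡_; _≢_)
open import Relation.Nullary using (¬_; Dec; yes; no)
open import Relation.Nullary.Decidable using (_⊎-dec_)
open import Function using (_∘_; _⇔_)
open import Function.Definitions using (Injective)

-- A finite (multi)graph: n vertices Fin n, m edges Fin m, each edge has
-- two endpoints.  Simplicity is a separate predicate.
record Graph : Set where
  field
    n : ℕ
    m : ℕ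
    ends : Fin m → Fin n × Fin n

open Graph public

SameEnds : ∀ {k} → Fin k × Fin k → Fin k × Fin k → Set
SameEnds (a , b) (c , d) = (a ≡ c × b ≡ d) ⊎ (a ≡ d × b ≡ c)

Simple : Graph → Set
Simple G = (∀ e → proj₁ (ends G e) ≢ proj₂ (ends G e))
         × (∀ e f → SameEnds (ends G e) (ends G f) → e ≡ f)

Incident : (G : Graph) → Fin (m G) → Fin (n G) → Set
Incident G e v = (v ≡ proj₁ (ends G e)) ⊎ (v ≡ proj₂ (ends G e))

incident? : (G : Graph) → ∀ e v → Dec (Incident G e v)
incident? G e v = (v ≟ proj₁ (ends G e)) ⊎-dec (v ≟ proj₂ (ends G e))

NoIsolated : Graph → Set
NoIsolated G = ∀ v → ∃[ e ] Incident G e v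

star : (G : Graph) → Fin (n G) → Subset (m G)
star G v = tabulate λ e → side (incident? G e v)
  where
  side : ∀ {A : Set} → Dec A → Side
  side (yes _) = inside
  side (no _)  = outside

MaximalStar : (G : Graph) → Subset (m G) → Set
MaximalStar G F = ∃[ v ] (F ≡ star G v × ¬ (∃[ u ] star G v ⊂ star G u))

ΣS : ∀ {k} → Subset k → (Fin k → ℚ) → ℚ
ΣS [] φ = 0ℚ
ΣS (inside ∷ F) φ = φ zero +ℚ ΣS F (φ ∘ suc)
ΣS (outside ∷ F) φ = ΣS F (φ ∘ suc)

Equistarable : Graph → Set
Equistarable G =
  NoIsolated G ×
  Σ (Fin (m G) → ℚ) λ φ →
    (∀ e → 0ℚ ≤ℚ φ e) ×
    (∀ (F : Subset (m G)) → (MaximalStar G F ⇔ (ΣS F φ ≡ 1ℚ)))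

data Reach (G : Graph) : Fin (n G) → Fin (n G) → Set where
  here : ∀ {v} → Reach G v v
  step : ∀ {u w v} (e : Fin (m G)) → SameEnds (ends G e) (u , w) →
         Reach G w v → Reach G u v

Connected : Graph → Set
Connected G = (n G ≥ 1) × (∀ u v → Reach G u v)

-- H is (isomorphic to) a connected component of G: H embeds in G via
-- injective vertex/edge maps preserving endpoints, H is connected, and
-- every edge of G incident with a vertex of (the image of) H lies in H.
IsComponent : Graph → Graph → Set
IsComponent H G =
  Σ (Fin (n H) → Fin (n G)) λ ιV →
  Σ (Fin (m H) → Fin (m G)) λ ιE →
    Injective _≡_ _≡_ ιV ×
    Injective _≡_ _≡_ ιE ×
    (∀ e → SameEnds (ends G (ιE e)) (ιV (proj₁ (ends H e)) , ιV (proj₂ (ends H e)))) ×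
    (∀ (f : Fin (m G)) (v : Fin (n H)) → Incident G f (ιV v) → ∃[ e ] ιE e ≡ f) ×
    Connected H

_⊕_ : Graph → Graph → Graph
G₁ ⊕ G₂ = record
  { n = n G₁ + n G₂
  ; m = m G₁ + m G₂
  ; ends = [ l , r ] ∘ splitAt (m G₁)
  }
  where
  l : Fin (m G₁) → Fin (n G₁ + n G₂) × Fin (n G₁ + n G₂)
  l e = (proj₁ (ends G₁ e) ↑ˡ n G₂) , (proj₂ (ends G₁ e) ↑ˡ n G₂)
  r : Fin (m G₂) → Fin (n G₁ + n G₂) × Fin (n G₁ + n G₂)
  r e = (n G₁ ↑ʳ proj₁ (ends G₂ e)) , (n G₁ ↑ʳ proj₂ (ends G₂ e))

-- A component H of G is closed under incident edges, so its edge set is embedded in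
-- that of G with sums preserved, and the stars of G rooted in H are exactly the images
-- of the stars of H, with the same strict inclusions; a star of G strictly containing
-- one rooted in H shares an edge with it and is therefore rooted in H too.  Hence the
-- restriction of an equistarable weighting of G works for H.  Conversely, in a triangle the three star equations
-- force every edge weight to be ½, so in two disjoint triangles an edge of each gives a
-- set of total weight 1 that is not a star.

module Submission where

open import Data.Bool using () renaming (_≟_ to _≟ᵇ_)
open import Data.Empty using (⊥-elim)
open import Data.Nat using (zero; suc)
open import Data.Fin using (Fin; zero; suc; #_) renaming (_≟_ to _≟ᶠ_)
open import Data.Fin.Properties using (suc-injective; any?; all?)
open import Data.Fin.Subset
  using (Subset; inside; outside; _∈_; _⊆_; _⊂_; _∪_; _∩_; ⁅_⁆; ⊥; Empty)
open import Data.Fin.Subset.Properties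
  using (∉⊥; x∈⁅x⁆; x∈⁅y⁆⇒x≡y; x∈p∪q⁺; x∈p∪q⁻; x∈p∩q⁻; ⊆-antisym; ⊆-reflexive; _⊂?_)
open import Data.Product using (∃-syntax; _×_; _,_; proj₁; proj₂)
open import Data.Rational using (ℚ; 0ℚ; 1ℚ; ½) renaming (_+_ to _+ℚ_)
open import Data.Rational.Properties as ℚ using (+-0-group; +-0-commutativeMonoid)
open import Data.Sum using (_⊎_; inj₁; inj₂) renaming (map to ⊎-map)
open import Data.Vec using ([]; _∷_; lookup; here; there)
open import Data.Vec.Properties using (≡-dec; lookup∘tabulate; []=⇒lookup; lookup⇒[]=)
open import Function using (_∘_; _⇔_; mk⇔; Equivalence)
open import Function.Definitions using (Injective)
open import Function.Construct.Composition using (_⇔-∘_)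
open import Relation.Binary using (tri<; tri≈; tri>)
open import Relation.Binary.PropositionalEquality
open import Relation.Nullary using (¬_; Dec; yes; no)
open import Relation.Nullary.Decidable using (map′; ¬?; _×-dec_; _⊎-dec_; _→-dec_; from-yes; from-no; True; toWitness)

open import Defs

open import Algebra.Bundles using (CommutativeMonoid)
open import Algebra.Properties.Group +-0-group using (∙-cancelˡ)
open import Algebra.Properties.CommutativeSemigroup
  (CommutativeMonoid.commutativeSemigroup +-0-commutativeMonoid) using (x∙yz≈y∙xz)

ΣS-⊥ : ∀ {k} (φ : Fin k → ℚ) → ΣS ⊥ φ ≡ 0ℚ
ΣS-⊥ {zero}  φ = refl
ΣS-⊥ {suc k} φ = ΣS-⊥ (φ ∘ suc)

ΣS-⁅⁆ : ∀ {k} (i : Fin k) (φ : Fin k → ℚ) → ΣS ⁅ i ⁆ φ ≡ φ i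
ΣS-⁅⁆ zero    φ = trans (cong (φ zero +ℚ_) (ΣS-⊥ (φ ∘ suc))) (ℚ.+-identityʳ (φ zero))
ΣS-⁅⁆ (suc i) φ = ΣS-⁅⁆ i (φ ∘ suc)

Empty-∷⁻ : ∀ {k s} {p : Subset k} → Empty (s ∷ p) → Empty p
Empty-∷⁻ s∷p=∅ (x , x∈p) = s∷p=∅ (suc x , there x∈p)

ΣS-∪ : ∀ {k} (p q : Subset k) (φ : Fin k → ℚ) → Empty (p ∩ q) →
       ΣS (p ∪ q) φ ≡ ΣS p φ +ℚ ΣS q φ
ΣS-∪ []            []            φ _ = sym (ℚ.+-identityˡ 0ℚ)
ΣS-∪ (inside ∷ p)  (inside ∷ q)  φ p∩q=∅ = ⊥-elim (p∩q=∅ (zero , here))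
ΣS-∪ (inside ∷ p)  (outside ∷ q) φ p∩q=∅ = begin
  φ zero +ℚ ΣS (p ∪ q) φ′              ≡⟨ cong (φ zero +ℚ_) (ΣS-∪ p q φ′ (Empty-∷⁻ p∩q=∅)) ⟩
  φ zero +ℚ (ΣS p φ′ +ℚ ΣS q φ′)       ≡⟨ ℚ.+-assoc (φ zero) (ΣS p φ′) (ΣS q φ′) ⟨
  φ zero +ℚ ΣS p φ′ +ℚ ΣS q φ′         ∎
  where open ≡-Reasoning; φ′ = φ ∘ suc
ΣS-∪ (outside ∷ p) (inside ∷ q)  φ p∩q=∅ = begin
  φ zero +ℚ ΣS (p ∪ q) φ′              ≡⟨ cong (φ zero +ℚ_) (ΣS-∪ p q φ′ (Empty-∷⁻ p∩q=∅)) ⟩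
  φ zero +ℚ (ΣS p φ′ +ℚ ΣS q φ′)       ≡⟨ x∙yz≈y∙xz (φ zero) (ΣS p φ′) (ΣS q φ′) ⟩
  ΣS p φ′ +ℚ (φ zero +ℚ ΣS q φ′)       ∎
  where open ≡-Reasoning; φ′ = φ ∘ suc
ΣS-∪ (outside ∷ p) (outside ∷ q) φ p∩q=∅ = ΣS-∪ p q (φ ∘ suc) (Empty-∷⁻ p∩q=∅)

image : ∀ {a b} → (Fin a → Fin b) → Subset a → Subset b
image ι []            = ⊥
image ι (inside ∷ p)  = ⁅ ι zero ⁆ ∪ image (ι ∘ suc) p
image ι (outside ∷ p) = image (ι ∘ suc) p

∈-image⁺ : ∀ {a b} (ι : Fin a → Fin b) {p x} → x ∈ p → ι x ∈ image ι p
∈-image⁺ ι {inside ∷ p}  here        = x∈p∪q⁺ (inj₁ (x∈⁅x⁆ (ι zero)))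
∈-image⁺ ι {inside ∷ p}  (there x∈p) = x∈p∪q⁺ (inj₂ (∈-image⁺ (ι ∘ suc) x∈p))
∈-image⁺ ι {outside ∷ p} (there x∈p) = ∈-image⁺ (ι ∘ suc) x∈p

∈-image⁻ : ∀ {a b} (ι : Fin a → Fin b) p {y} → y ∈ image ι p → ∃[ x ] x ∈ p × ι x ≡ y
∈-image⁻ ι []            y∈ = ⊥-elim (∉⊥ y∈)
∈-image⁻ ι (inside ∷ p)  y∈ with x∈p∪q⁻ ⁅ ι zero ⁆ (image (ι ∘ suc) p) y∈
... | inj₁ y∈⁅ι0⁆ = zero , here , sym (x∈⁅y⁆⇒x≡y (ι zero) y∈⁅ι0⁆)
... | inj₂ y∈ιp   with ∈-image⁻ (ι ∘ suc) p y∈ιp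
...   | x , x∈p , refl = suc x , there x∈p , refl
∈-image⁻ ι (outside ∷ p) y∈ with ∈-image⁻ (ι ∘ suc) p y∈
... | x , x∈p , refl = suc x , there x∈p , refl

ΣS-image : ∀ {a b} {ι : Fin a → Fin b} → Injective _≡_ _≡_ ι →
           ∀ p (φ : Fin b → ℚ) → ΣS (image ι p) φ ≡ ΣS p (φ ∘ ι)
ΣS-image {ι = ι} ι-inj []            φ = ΣS-⊥ φ
ΣS-image {ι = ι} ι-inj (inside ∷ p)  φ = begin
  ΣS (⁅ ι zero ⁆ ∪ image (ι ∘ suc) p) φ         ≡⟨ ΣS-∪ ⁅ ι zero ⁆ _ φ ι0∉ιp ⟩
  ΣS ⁅ ι zero ⁆ φ +ℚ ΣS (image (ι ∘ suc) p) φ   ≡⟨ cong₂ _+ℚ_ (ΣS-⁅⁆ (ι zero) φ)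
                                                              (ΣS-image (suc-injective ∘ ι-inj) p φ) ⟩
  φ (ι zero) +ℚ ΣS p (φ ∘ ι ∘ suc)              ∎
  where
  open ≡-Reasoning
  ι0∉ιp : Empty (⁅ ι zero ⁆ ∩ image (ι ∘ suc) p)
  ι0∉ιp (y , y∈) with x∈p∩q⁻ ⁅ ι zero ⁆ _ y∈
  ... | y∈⁅ι0⁆ , y∈ιp with ∈-image⁻ (ι ∘ suc) p y∈ιp
  ...   | x , _ , ιsx≡y with ι-inj (trans ιsx≡y (x∈⁅y⁆⇒x≡y (ι zero) y∈⁅ι0⁆))
  ...     | ()
ΣS-image {ι = ι} ι-inj (outside ∷ p) φ = ΣS-image (suc-injective ∘ ι-inj) p φ

image-⊆⁺ : ∀ {a b} (ι : Fin a → Fin b) {p q} → p ⊆ q → image ι p ⊆ image ι q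
image-⊆⁺ ι {p} p⊆q y∈ιp with ∈-image⁻ ι p y∈ιp
... | x , x∈p , refl = ∈-image⁺ ι (p⊆q x∈p)

module _ {a b} {ι : Fin a → Fin b} (ι-inj : Injective _≡_ _≡_ ι) where

  ∈-image-injective : ∀ {p x} → ι x ∈ image ι p → x ∈ p
  ∈-image-injective {p} ιx∈ιp with ∈-image⁻ ι p ιx∈ιp
  ... | x , x∈p , ιx≡ιx′ = subst (_∈ p) (ι-inj ιx≡ιx′) x∈p

  image-⊆⁻ : ∀ {p q} → image ι p ⊆ image ι q → p ⊆ q
  image-⊆⁻ ιp⊆ιq x∈p = ∈-image-injective (ιp⊆ιq (∈-image⁺ ι x∈p))

  image-injective : Injective _≡_ _≡_ (image ι)
  image-injective ιp≡ιq =
    ⊆-antisym (image-⊆⁻ (⊆-reflexive ιp≡ιq)) (image-⊆⁻ (⊆-reflexive (sym ιp≡ιq)))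

  image-⊂⁺ : ∀ {p q} → p ⊂ q → image ι p ⊂ image ι q
  image-⊂⁺ (p⊆q , x , x∈q , x∉p) =
    image-⊆⁺ ι p⊆q , ι x , ∈-image⁺ ι x∈q , x∉p ∘ ∈-image-injective

  image-⊂⁻ : ∀ {p q} → image ι p ⊂ image ι q → p ⊂ q
  image-⊂⁻ {q = q} (ιp⊆ιq , y , y∈ιq , y∉ιp) with ∈-image⁻ ι q y∈ιq
  ... | x , x∈q , refl = image-⊆⁻ ιp⊆ιq , x , x∈q , y∉ιp ∘ ∈-image⁺ ι

-- star G v tabulates a function local to Defs; the first with unfolds the lookup so
-- that the second can split on incident? G e v inside it.
∈-star⁻ : ∀ G {v e} → e ∈ star G v → Incident G e v
∈-star⁻ G {v} {e} e∈ with trans (sym (lookup∘tabulate _ e)) ([]=⇒lookup e∈)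
... | _ with incident? G e v
...   | yes e∼v = e∼v

∈-star⁺ : ∀ G {v e} → Incident G e v → e ∈ star G v
∈-star⁺ G {v} {e} e∼v with lookup (star G v) e in eq
... | inside  = lookup⇒[]= e (star G v) eq
... | outside with trans (sym (lookup∘tabulate _ e)) eq
...   | _ with incident? G e v
...     | no e≁v = ⊥-elim (e≁v e∼v)

SameEnds-sym : ∀ {k} {p q : Fin k × Fin k} → SameEnds p q → SameEnds q p
SameEnds-sym (inj₁ (a≡c , b≡d)) = inj₁ (sym a≡c , sym b≡d)
SameEnds-sym (inj₂ (a≡d , b≡c)) = inj₂ (sym b≡c , sym a≡d)

SameEnds-endpoint : ∀ {k} {p q : Fin k × Fin k} {w} → SameEnds p q →
                    w ≡ proj₁ p ⊎ w ≡ proj₂ p → w ≡ proj₁ q ⊎ w ≡ proj₂ q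
SameEnds-endpoint (inj₁ (a≡c , _))   (inj₁ w≡a) = inj₁ (trans w≡a a≡c)
SameEnds-endpoint (inj₁ (_ , b≡d))   (inj₂ w≡b) = inj₂ (trans w≡b b≡d)
SameEnds-endpoint (inj₂ (a≡d , _))   (inj₁ w≡a) = inj₂ (trans w≡a a≡d)
SameEnds-endpoint (inj₂ (_ , b≡c))   (inj₂ w≡b) = inj₁ (trans w≡b b≡c)

module Embedding
  {G H : Graph} (ιV : Fin (n H) → Fin (n G)) (ιE : Fin (m H) → Fin (m G))
  (ιV-inj : Injective _≡_ _≡_ ιV) (ιE-inj : Injective _≡_ _≡_ ιE)
  (ends-ι : ∀ e → SameEnds (ends G (ιE e)) (ιV (proj₁ (ends H e)) , ιV (proj₂ (ends H e))))
  (closed : ∀ f v → Incident G f (ιV v) → ∃[ e ] ιE e ≡ f)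
  where

  incident-ι⁺ : ∀ {e v} → Incident H e v → Incident G (ιE e) (ιV v)
  incident-ι⁺ {e} e∼v =
    SameEnds-endpoint (SameEnds-sym (ends-ι e)) (⊎-map (cong ιV) (cong ιV) e∼v)

  endpoint-ι : ∀ {e w} → Incident G (ιE e) w → ∃[ v ] w ≡ ιV v × Incident H e v
  endpoint-ι {e} ιe∼w with SameEnds-endpoint (ends-ι e) ιe∼w
  ... | inj₁ w≡ = proj₁ (ends H e) , w≡ , inj₁ refl
  ... | inj₂ w≡ = proj₂ (ends H e) , w≡ , inj₂ refl

  incident-ι⁻ : ∀ {f v} → Incident G f (ιV v) → ∃[ e ] ιE e ≡ f × Incident H e v
  incident-ι⁻ {f} {v} f∼ιVv with closed f v f∼ιVv
  ... | e , refl with endpoint-ι f∼ιVv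
  ...   | u , ιVv≡ιVu , e∼u = e , refl , subst (Incident H e) (sym (ιV-inj ιVv≡ιVu)) e∼u

  star-ι : ∀ v → star G (ιV v) ≡ image ιE (star H v)
  star-ι v = ⊆-antisym ⊆ι ι⊆
    where
    ⊆ι : star G (ιV v) ⊆ image ιE (star H v)
    ⊆ι f∈ with incident-ι⁻ (∈-star⁻ G f∈)
    ... | e , refl , e∼v = ∈-image⁺ ιE (∈-star⁺ H e∼v)
    ι⊆ : image ιE (star H v) ⊆ star G (ιV v)
    ι⊆ f∈ with ∈-image⁻ ιE (star H v) f∈
    ... | e , e∈ , refl = ∈-star⁺ G (incident-ι⁺ (∈-star⁻ H e∈))

  root-ι : ∀ {e w} → ιE e ∈ star G w → ∃[ v ] w ≡ ιV v
  root-ι ιe∈ with endpoint-ι (∈-star⁻ G ιe∈)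
  ... | v , w≡ιVv , _ = v , w≡ιVv

  noIsolated-ι : NoIsolated G → NoIsolated H
  noIsolated-ι noIsolatedG v with incident-ι⁻ (proj₂ (noIsolatedG (ιV v)))
  ... | e , _ , e∼v = e , e∼v

  maximalStar-ι : NoIsolated G → ∀ F → MaximalStar H F ⇔ MaximalStar G (image ιE F)
  maximalStar-ι noIsolatedG F = mk⇔ to from
    where
    to : MaximalStar H F → MaximalStar G (image ιE F)
    to (v , refl , v-max) = ιV v , sym (star-ι v) , ιV-max
      where
      ιV-max : ¬ (∃[ w ] star G (ιV v) ⊂ star G w)
      ιV-max (w , ⊂w) with noIsolatedG (ιV v)
      ... | f , f∼ιVv with incident-ι⁻ f∼ιVv
      ...   | e , refl , _ with root-ι (proj₁ ⊂w (∈-star⁺ G f∼ιVv))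
      ...     | u , refl = v-max (u , image-⊂⁻ ιE-inj (subst₂ _⊂_ (star-ι v) (star-ι u) ⊂w))
    from : MaximalStar G (image ιE F) → MaximalStar H F
    from (w , ιF≡ , w-max) with noIsolatedG w
    ... | f , f∼w with ∈-image⁻ ιE F (subst (f ∈_) (sym ιF≡) (∈-star⁺ G f∼w))
    ...   | e , _ , refl with root-ι (∈-star⁺ G f∼w)
    ...     | v , refl = v , image-injective ιE-inj (trans ιF≡ (star-ι v)) , v-max
      where
      v-max : ¬ (∃[ u ] star H v ⊂ star H u)
      v-max (u , ⊂u) =
        w-max (ιV u , subst₂ _⊂_ (sym (star-ι v)) (sym (star-ι u)) (image-⊂⁺ ιE-inj ⊂u))

component-equistarable : ∀ G → Equistarable G → ∀ H → IsComponent H G → Equistarable H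
component-equistarable G (noIsolatedG , φ , φ≥0 , starSum⇔) H
                       (ιV , ιE , ιV-inj , ιE-inj , ends-ι , closed , _) =
  noIsolated-ι noIsolatedG , φ ∘ ιE , φ≥0 ∘ ιE , λ F →
    subst (λ s → MaximalStar H F ⇔ (s ≡ 1ℚ)) (ΣS-image ιE-inj F φ)
          (starSum⇔ (image ιE F) ⇔-∘ maximalStar-ι noIsolatedG F)
  where open Embedding ιV ιE ιV-inj ιE-inj ends-ι closed

sameEnds? : ∀ {k} (p q : Fin k × Fin k) → Dec (SameEnds p q)
sameEnds? (a , b) (c , d) = ((a ≟ᶠ c) ×-dec (b ≟ᶠ d)) ⊎-dec ((a ≟ᶠ d) ×-dec (b ≟ᶠ c))

simple? : ∀ G → Dec (Simple G)
simple? G = all? (λ e → ¬? (proj₁ (ends G e) ≟ᶠ proj₂ (ends G e)))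
      ×-dec all? (λ e → all? (λ f → sameEnds? (ends G e) (ends G f) →-dec (e ≟ᶠ f)))

noIsolated? : ∀ G → Dec (NoIsolated G)
noIsolated? G = all? (λ v → any? (λ e → incident? G e v))

maximalStar? : ∀ G F → Dec (MaximalStar G F)
maximalStar? G F =
  any? (λ v → ≡-dec _≟ᵇ_ F (star G v) ×-dec ¬? (any? (λ u → star G v ⊂? star G u)))

allSubsets? : ∀ {k} {P : Subset k → Set} → (∀ p → Dec (P p)) → Dec (∀ p → P p)
allSubsets? {zero}  P? = map′ (λ { P[] [] → P[] }) (λ ∀P → ∀P []) (P? [])
allSubsets? {suc k} P? =
  map′ (λ { (∀Pin , ∀Pout) (inside ∷ p) → ∀Pin p ; (∀Pin , ∀Pout) (outside ∷ p) → ∀Pout p })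
       (λ ∀P → (∀P ∘ (inside ∷_)) , (∀P ∘ (outside ∷_)))
       (allSubsets? (P? ∘ (inside ∷_)) ×-dec allSubsets? (P? ∘ (outside ∷_)))

_⇔-dec_ : ∀ {A B : Set} → Dec A → Dec B → Dec (A ⇔ B)
A? ⇔-dec B? = map′ (λ (f , g) → mk⇔ f g) (λ A⇔B → Equivalence.to A⇔B , Equivalence.from A⇔B)
                   ((A? →-dec B?) ×-dec (B? →-dec A?))

starSums? : ∀ G (φ : Fin (m G) → ℚ) → Dec (∀ F → MaximalStar G F ⇔ (ΣS F φ ≡ 1ℚ))
starSums? G φ = allSubsets? (λ F → maximalStar? G F ⇔-dec (ΣS F φ ℚ.≟ 1ℚ))

K₃ : Graph
K₃ = record { n = 3 ; m = 3 ; ends = ends₃ }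
  where
  ends₃ : Fin 3 → Fin 3 × Fin 3
  ends₃ zero             = # 0 , # 1
  ends₃ (suc zero)       = # 1 , # 2
  ends₃ (suc (suc zero)) = # 0 , # 2

K₃-simple : Simple K₃
K₃-simple = from-yes (simple? K₃)

K₃-equistarable : Equistarable K₃
K₃-equistarable =
  from-yes (noIsolated? K₃) , (λ _ → ½) , (λ _ → from-yes (0ℚ ℚ.≤? ½)) ,
  from-yes (starSums? K₃ (λ _ → ½))

x+x≡y+y⇒x≡y : ∀ x y → x +ℚ x ≡ y +ℚ y → x ≡ y
x+x≡y+y⇒x≡y x y x+x≡y+y with ℚ.<-cmp x y
... | tri< x<y _ _ = ⊥-elim (ℚ.<-irrefl x+x≡y+y (ℚ.+-mono-< x<y x<y))
... | tri≈ _ x≡y _ = x≡y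
... | tri> _ _ y<x = ⊥-elim (ℚ.<-irrefl (sym x+x≡y+y) (ℚ.+-mono-< y<x y<x))

triangle-½ : ∀ {x y z} → x +ℚ y ≡ 1ℚ → x +ℚ z ≡ 1ℚ → y +ℚ z ≡ 1ℚ → y ≡ ½
triangle-½ {x} {y} {z} x+y≡1 x+z≡1 y+z≡1 = x+x≡y+y⇒x≡y y ½ (begin
  y +ℚ y   ≡⟨ cong (y +ℚ_) (∙-cancelˡ x y z (trans x+y≡1 (sym x+z≡1))) ⟩
  y +ℚ z   ≡⟨ y+z≡1 ⟩
  1ℚ       ∎)
  where open ≡-Reasoning

-- In K₃ ⊕ K₃ the vertices and edges 0–2 form the first triangle and 3–5 the second;
-- e.g. the star at vertex 1 is {0, 1}.
K₃⊕K₃-not-equistarable : ¬ Equistarable (K₃ ⊕ K₃)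
K₃⊕K₃-not-equistarable (_ , φ , _ , starSum⇔) =
  from-no (maximalStar? U F) (Equivalence.from (starSum⇔ F) F-sum)
  where
  U : Graph
  U = K₃ ⊕ K₃

  F : Subset 6
  F = ⁅ # 1 ⁆ ∪ ⁅ # 4 ⁆

  starSum : ∀ v {_ : True (maximalStar? U (star U v))} → ΣS (star U v) φ ≡ 1ℚ
  starSum v {maximal} = Equivalence.to (starSum⇔ (star U v)) (toWitness maximal)

  pairSum : ∀ e e′ → φ e +ℚ (φ e′ +ℚ 0ℚ) ≡ 1ℚ → φ e +ℚ φ e′ ≡ 1ℚ
  pairSum e e′ = subst (λ t → φ e +ℚ t ≡ 1ℚ) (ℚ.+-identityʳ (φ e′))

  φ₁≡½ : φ (# 1) ≡ ½
  φ₁≡½ = triangle-½ {φ (# 0)} (pairSum (# 0) (# 1) (starSum (# 1)))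
                              (pairSum (# 0) (# 2) (starSum (# 0)))
                              (pairSum (# 1) (# 2) (starSum (# 2)))

  φ₄≡½ : φ (# 4) ≡ ½
  φ₄≡½ = triangle-½ {φ (# 3)} (pairSum (# 3) (# 4) (starSum (# 4)))
                              (pairSum (# 3) (# 5) (starSum (# 3)))
                              (pairSum (# 4) (# 5) (starSum (# 5)))

  F-sum : ΣS F φ ≡ 1ℚ
  F-sum = cong₂ (λ a b → a +ℚ (b +ℚ 0ℚ)) φ₁≡½ φ₄≡½

lemma4 : ((G : Graph) → Simple G → Equistarable G →
           ∀ (H : Graph) → IsComponent H G → Equistarable H)
         × (∃[ G₁ ] ∃[ G₂ ] (Simple G₁ × Simple G₂ × Equistarable G₁ × Equistarable G₂
                             × ¬ Equistarable (G₁ ⊕ G₂)))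
lemma4 = (λ G _ → component-equistarable G)
       , K₃ , K₃ , K₃-simple , K₃-simple , K₃-equistarable , K₃-equistarable
       , K₃⊕K₃-not-equistarable
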